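{- Let $A$ be a cyclically almost $2$-diagonal array of size $n\ge3$ in standard form, with extra filled cell $(1,\ell)$. Then the following is a solution of $P(A)$: $R=(1,\dots,1)$, and $C\in\{ -1,1\}^n$ with $c_\ell=-1$ and $c_j=1$ for $j\ne\ell$.
   Context: Arrays are toroidal: an $n\times n$ array has rows and columns indexed modulo $n$ (representatives $1,\dots,n$). Each cell is filled or empty; $F(A)$ is the set of filled cells. For $(i,j)\in F(A)$: - the row successor $s_r((i,j))$ is $(i,j+k)$ with $k\ge1$ minimal such that $(i,j+k)\in F(A)$; - the column successor $s_c((i,j))$ is $(i+k,j)$ with $k\ge1$ minimal such that $(i+k,j)\in F(A)$. Given $R,C\in\{ -1,1\}^n$, the move function is $S_{R,C}((i,j))=s_c^{\,c_{j'}}((i,j'))$, where $(i,j')=s_r^{\,r_i}((i,j))$; exponent $-1$ means inverse. $R,C$ is a solution of $P(A)$ if $S_{R,C}$ is a single cycle on $F(A)$. Diagonals: $D_i=\{(i+t-1,t): t=1,\dots,n\}$, with row indices modulo $n$. A cyclically almost $k$-diagonal array of size $n>k$ is a square array whose filled cells are exactly the cells of $k$ diagonals consecutive modulo $n$, plus one extra filled cell lying in another diagonal. Standard form: such an array is in standard form if the totally filled diagonals are $D_1,\dots,D_k$ and the extra cell is $(1,\ell)$ with $2\le\ell\le n-k+1$. -}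

module Defs where

open import Data.Nat using (ℕ; zero; suc; _+_; _∸_; _≤_; _<_)
open import Data.Nat.DivMod using (_mod_; _%_)
open import Data.Fin using (Fin; toℕ)
open import Data.Bool using (Bool; true; false; if_then_else_)
open import Data.Sign using (Sign) renaming (+ to pos; - to neg)
open import Data.Product using (_×_; _,_; ∃; Σ)
open import Data.Sum using (_⊎_)
open import Relation.Binary.PropositionalEquality using (_≡_)
open import Function.Bundles using (_⇔_)
import Data.Product
import Data.Nat
import Relation.Nullary

-- Rows and columns are 0-based: the paper's index i ∈ {1,…,n} is Fin value i-1.
-- We work with n = suc m so that arithmetic mod n is available.

Array : ℕ → Set
Array n = Fin n → Fin n → Bool

Cell : ℕ → Set
Cell n = Fin n × Fin n

Filled : ∀ {m} → Array (suc m) → Cell (suc m) → Set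
Filled A (r , c) = A r c ≡ true

-- j + k  and  j - k  modulo n = suc m  (the latter for k ≤ n)
shiftF : ∀ {m} → Fin (suc m) → ℕ → Fin (suc m)
shiftF {m} j k = (toℕ j + k) mod (suc m)

shiftB : ∀ {m} → Fin (suc m) → ℕ → Fin (suc m)
shiftB {m} j k = (toℕ j + suc m ∸ k) mod (suc m)

-- least k ∈ {start, …, start+fuel-1} with P k = true (fallback: start+fuel)
firstFrom : ℕ → ℕ → (ℕ → Bool) → ℕ
firstFrom zero    k P = k
firstFrom (suc f) k P = if P k then k else firstFrom f (suc k) P

-- least k with 1 ≤ k ≤ n satisfying P (exists for filled cells, as k = n returns to the cell)
leastPos : ℕ → (ℕ → Bool) → ℕ
leastPos n P = firstFrom n 1 P

sr : ∀ {m} → Array (suc m) → Cell (suc m) → Cell (suc m)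
sr {m} A (i , j) = i , shiftF j (leastPos (suc m) (λ k → A i (shiftF j k)))

sr⁻¹ : ∀ {m} → Array (suc m) → Cell (suc m) → Cell (suc m)
sr⁻¹ {m} A (i , j) = i , shiftB j (leastPos (suc m) (λ k → A i (shiftB j k)))

sc : ∀ {m} → Array (suc m) → Cell (suc m) → Cell (suc m)
sc {m} A (i , j) = shiftF i (leastPos (suc m) (λ k → A (shiftF i k) j)) , j

sc⁻¹ : ∀ {m} → Array (suc m) → Cell (suc m) → Cell (suc m)
sc⁻¹ {m} A (i , j) = shiftB i (leastPos (suc m) (λ k → A (shiftB i k) j)) , j

rowStep : ∀ {m} → Array (suc m) → Sign → Cell (suc m) → Cell (suc m)
rowStep A pos = sr A
rowStep A neg = sr⁻¹ A

colStep : ∀ {m} → Array (suc m) → Sign → Cell (suc m) → Cell (suc m)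
colStep A pos = sc A
colStep A neg = sc⁻¹ A

S : ∀ {m} → Array (suc m) → (Fin (suc m) → Sign) → (Fin (suc m) → Sign)
    → Cell (suc m) → Cell (suc m)
S A R C (i , j) with rowStep A (R i) (i , j)
... | (i' , j') = colStep A (C j') (i' , j')

iter : ∀ {X : Set} → (X → X) → ℕ → X → X
iter f zero    x = x
iter f (suc k) x = f (iter f k x)

-- S is a single cycle on F(A): it maps F(A) into F(A) and every filled cell
-- is reached from every filled cell by iterating S (on a finite set this
-- forces S to be a cyclic permutation of F(A)).
SingleCycle : ∀ {m} → Array (suc m) → (Cell (suc m) → Cell (suc m)) → Set
SingleCycle A f =
  (∀ x → Filled A x → Filled A (f x)) ×
  (∀ x y → Filled A x → Filled A y → ∃ λ k → iter f k x ≡ y)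

IsSolution : ∀ {m} → Array (suc m) → (Fin (suc m) → Sign) → (Fin (suc m) → Sign) → Set
IsSolution A R C = SingleCycle A (S A R C)

-- diagonal D_d (d 1-based): cells (d+t-1, t); in 0-based indices r ≡ (d-1) + c mod n
InDiag : ∀ {m} → ℕ → Cell (suc m) → Set
InDiag {m} d (r , c) = toℕ r ≡ (d ∸ 1 + toℕ c) % suc m

-- cyclically almost k-diagonal array of size n = suc m > k in standard form,
-- with extra filled cell (1,ℓ) (1-based ℓ, 2 ≤ ℓ ≤ n-k+1): filled cells are exactly
-- those of D_1,…,D_k together with (1,ℓ).
StdAlmostDiag : ∀ {m} → ℕ → Array (suc m) → ℕ → Set
StdAlmostDiag {m} k A ℓ =
  k < suc m × 2 ≤ ℓ × ℓ ≤ suc m ∸ k + 1 ×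
  (∀ (x : Cell (suc m)) →
     Filled A x ⇔ ((Σ ℕ λ d → 1 ≤ d × d ≤ k × InDiag d x)
                  ⊎ (toℕ (Data.Product.proj₁ x) ≡ 0 × toℕ (Data.Product.proj₂ x) + 1 ≡ ℓ)))

allPos : ∀ {n} → Fin n → Sign
allPos _ = pos

negAt : ∀ {n} → ℕ → Fin n → Sign
negAt ℓ j with toℕ j + 1 Data.Nat.≟ ℓ
... | Relation.Nullary.yes _ = neg
... | Relation.Nullary.no  _ = pos

module Submission where

-- In 0-based coordinates with n = m + 1 and e = ℓ - 1 (so 1 ≤ e < m) the filled cells are
-- (c, c), (c+1, c), the corner (0, m) and the extra cell (0, e), and the orbit of (0, 0) is
--   (0,0) → (e+1,e) → … → (m,m-1) → (0,m) → (1,0) → … → (e,e-1) → (0,e) → (m,m) → … → (0,0).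

open import Defs
open import Data.Nat using (ℕ; zero; suc; _+_; _∸_; _≤_; _<_; z≤n; s≤s; _%_; NonZero; _<?_; _≟_; s≤s⁻¹; pred)
open import Data.Nat.Properties
open import Data.Nat.DivMod using (m<n⇒m%n≡m; [m+n]%n≡m%n; m%n<n; n%n≡0)
open import Data.Fin using (Fin; toℕ; zero)
open import Data.Fin.Properties using (toℕ<n; toℕ-fromℕ<; toℕ-injective)
open import Data.Bool using (Bool; true; false)
open import Data.Bool.Properties using (¬-not)
open import Data.Product using (Σ; _×_; _,_; proj₁; proj₂; ∃; ∃₂)
open import Data.Sum using (_⊎_; inj₁; inj₂)
import Data.Sum
open import Data.Empty using (⊥-elim)
open import Function.Bundles using (_⇔_; Equivalence; mk⇔)
open import Relation.Nullary using (¬_; contradiction; yes; no; Dec)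
open import Relation.Binary.PropositionalEquality
open import Data.Sign using () renaming (+ to pos; - to neg)

firstFrom-least : ∀ f s (P : ℕ → Bool) K → s ≤ K → K < s + f → P K ≡ true
                → (∀ k → s ≤ k → k < K → P k ≡ false) → firstFrom f s P ≡ K
firstFrom-least zero s P K s≤K K<s+0 _ _ =
  contradiction s≤K (<⇒≱ (subst (K <_) (+-identityʳ s) K<s+0))
firstFrom-least (suc f) s P K s≤K K<s+f PK before with P s in Ps
... | true with m≤n⇒m<n∨m≡n s≤K
...   | inj₁ s<K = contradiction (trans (sym Ps) (before s ≤-refl s<K)) λ ()
...   | inj₂ s≡K = s≡K
firstFrom-least (suc f) s P K s≤K K<s+f PK before | false =
  firstFrom-least f (suc s) P K s<K (subst (K <_) (+-suc s f) K<s+f) PK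
    (λ k s<k k<K → before k (<⇒≤ s<k) k<K)
  where
  s<K : s < K
  s<K = ≤∧≢⇒< s≤K (λ s≡K → contradiction (trans (sym Ps) (trans (cong P s≡K) PK)) λ ())

leastPos-least : ∀ n (P : ℕ → Bool) K → 1 ≤ K → K ≤ n → P K ≡ true
               → (∀ k → 1 ≤ k → k < K → P k ≡ false) → leastPos n P ≡ K
leastPos-least n P K 1≤K K≤n = firstFrom-least n 1 P K 1≤K (s≤s K≤n)

+-gap : ∀ a k b K → a + k ≡ b + K → k < K → b < a
+-gap a k b K a+k≡b+K k<K =
  +-cancelʳ-< K b a (subst (_< a + K) a+k≡b+K (+-monoʳ-< a k<K))

no-between : ∀ {c r} → c < r → ¬ r < suc c
no-between c<r r<1+c = <⇒≱ c<r (s≤s⁻¹ r<1+c)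

nextF : ∀ {m} → (Fin (suc m) → Bool) → Fin (suc m) → Fin (suc m)
nextF {m} P j = shiftF j (leastPos (suc m) (λ k → P (shiftF j k)))

nextB : ∀ {m} → (Fin (suc m) → Bool) → Fin (suc m) → Fin (suc m)
nextB {m} P j = shiftB j (leastPos (suc m) (λ k → P (shiftB j k)))

mod-below-twice : ∀ n x .{{_ : NonZero n}} → x < n + n → x % n ≡ x ⊎ x % n + n ≡ x
mod-below-twice n x x<2n with x <? n
... | yes x<n = inj₁ (m<n⇒m%n≡m x<n)
... | no x≮n with d , refl ← m≤n⇒∃[o]m+o≡n (≮⇒≥ x≮n) = inj₂ (begin
  (n + d) % n + n ≡⟨ cong (λ y → y % n + n) (+-comm n d) ⟩
  (d + n) % n + n ≡⟨ cong (_+ n) ([m+n]%n≡m%n d n) ⟩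
  d % n + n       ≡⟨ cong (_+ n) (m<n⇒m%n≡m (+-cancelˡ-< n d n x<2n)) ⟩
  d + n           ≡⟨ +-comm d n ⟩
  n + d           ∎)
  where open ≡-Reasoning

shiftF-value : ∀ {m} (j : Fin (suc m)) k → k ≤ suc m →
               toℕ (shiftF j k) ≡ toℕ j + k ⊎ toℕ (shiftF j k) + suc m ≡ toℕ j + k
shiftF-value {m} j k k≤n rewrite toℕ-fromℕ< (m%n<n (toℕ j + k) (suc m)) =
  mod-below-twice (suc m) (toℕ j + k) (+-mono-<-≤ (toℕ<n j) k≤n)

shiftB-value : ∀ {m} (j : Fin (suc m)) k → k ≤ suc m →
               toℕ (shiftB j k) + k ≡ toℕ j + suc m ⊎ toℕ (shiftB j k) + k ≡ toℕ j
shiftB-value {m} j k k≤n rewrite toℕ-fromℕ< (m%n<n (toℕ j + suc m ∸ k) (suc m)) =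
  Data.Sum.map unwrapped wrapped (mod-below-twice n x x<2n)
  where
  open ≡-Reasoning
  n x : ℕ
  n = suc m
  x = toℕ j + n ∸ k
  k≤j+n : k ≤ toℕ j + n
  k≤j+n = ≤-trans k≤n (m≤n+m n (toℕ j))
  x<2n : x < n + n
  x<2n = ≤-<-trans (m∸n≤m (toℕ j + n) k) (+-monoˡ-< n (toℕ<n j))
  unwrapped : x % n ≡ x → x % n + k ≡ toℕ j + n
  unwrapped t≡x = trans (cong (_+ k) t≡x) (m∸n+n≡m k≤j+n)
  wrapped : x % n + n ≡ x → x % n + k ≡ toℕ j
  wrapped t+n≡x = +-cancelʳ-≡ n _ _ (begin
    x % n + k + n   ≡⟨ +-assoc (x % n) k n ⟩
    x % n + (k + n) ≡⟨ cong (x % n +_) (+-comm k n) ⟩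
    x % n + (n + k) ≡⟨ +-assoc (x % n) n k ⟨
    x % n + n + k   ≡⟨ cong (_+ k) t+n≡x ⟩
    x + k           ≡⟨ m∸n+n≡m k≤j+n ⟩
    toℕ j + n       ∎)

module Line {m : ℕ} (P : Fin (suc m) → Bool) (L : ℕ → Set)
            (P⇔L : ∀ c → P c ≡ true ⇔ L (toℕ c)) where

  private
    n : ℕ
    n = suc m

    filled : ∀ c → L (toℕ c) → P c ≡ true
    filled c = Equivalence.from (P⇔L c)

    empty : ∀ c → ¬ L (toℕ c) → P c ≡ false
    empty c ¬Lc = ¬-not (λ Pc → ¬Lc (Equivalence.to (P⇔L c) Pc))

  nextF-shift : ∀ j K → 1 ≤ K → K ≤ n → L (toℕ (shiftF j K))
              → (∀ k → 1 ≤ k → k < K → ¬ L (toℕ (shiftF j k))) → nextF P j ≡ shiftF j K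
  nextF-shift j K 1≤K K≤n hit gap = cong (shiftF j)
    (leastPos-least n _ K 1≤K K≤n (filled _ hit) (λ k 1≤k k<K → empty _ (gap k 1≤k k<K)))

  nextB-shift : ∀ j K → 1 ≤ K → K ≤ n → L (toℕ (shiftB j K))
              → (∀ k → 1 ≤ k → k < K → ¬ L (toℕ (shiftB j k))) → nextB P j ≡ shiftB j K
  nextB-shift j K 1≤K K≤n hit gap = cong (shiftB j)
    (leastPos-least n _ K 1≤K K≤n (filled _ hit) (λ k 1≤k k<K → empty _ (gap k 1≤k k<K)))

  nextF-ahead : ∀ j b → toℕ j < b → b < n → L b → (∀ c → toℕ j < c → c < b → ¬ L c)
              → toℕ (nextF P j) ≡ b
  nextF-ahead j b j<b b<n Lb gap =
    trans (cong toℕ (nextF-shift j K (m<n⇒0<n∸m j<b) K≤n (subst L (sym land) Lb) miss)) land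
    where
    K : ℕ
    K = b ∸ toℕ j
    K≤n : K ≤ n
    K≤n = ≤-trans (m∸n≤m b (toℕ j)) (<⇒≤ b<n)
    j+K≡b : toℕ j + K ≡ b
    j+K≡b = m+[n∸m]≡n (<⇒≤ j<b)
    no-wrap : ∀ {t k} → k ≤ K → t + n ≢ toℕ j + k
    no-wrap {t} {k} k≤K e = <⇒≱ b<n (begin
      n ≤⟨ m≤n+m n t ⟩ t + n ≡⟨ e ⟩ toℕ j + k ≤⟨ +-monoʳ-≤ (toℕ j) k≤K ⟩
      toℕ j + K ≡⟨ j+K≡b ⟩ b ∎)
      where open ≤-Reasoning
    land : toℕ (shiftF j K) ≡ b
    land with shiftF-value j K K≤n
    ... | inj₁ t≡ = trans t≡ j+K≡b
    ... | inj₂ t+n≡ = ⊥-elim (no-wrap ≤-refl t+n≡)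
    miss : ∀ k → 1 ≤ k → k < K → ¬ L (toℕ (shiftF j k))
    miss k 1≤k k<K with shiftF-value j k (≤-trans (<⇒≤ k<K) K≤n)
    ... | inj₁ t≡ rewrite t≡ = gap (toℕ j + k) (m<m+n (toℕ j) 1≤k)
                                   (subst (toℕ j + k <_) j+K≡b (+-monoʳ-< (toℕ j) k<K))
    ... | inj₂ t+n≡ = λ _ → no-wrap (<⇒≤ k<K) t+n≡

  nextF-around : ∀ j b → b ≤ toℕ j → L b → (∀ c → c < n → toℕ j < c ⊎ c < b → ¬ L c)
               → toℕ (nextF P j) ≡ b
  nextF-around j b b≤j Lb gap =
    trans (cong toℕ (nextF-shift j K 1≤K K≤n (subst L (sym land) Lb) miss)) land
    where
    j<n+b : toℕ j < n + b
    j<n+b = ≤-trans (toℕ<n j) (m≤m+n n b)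
    K : ℕ
    K = n + b ∸ toℕ j
    1≤K : 1 ≤ K
    1≤K = m<n⇒0<n∸m j<n+b
    K≤n : K ≤ n
    K≤n = ≤-trans (∸-monoʳ-≤ (n + b) b≤j) (≤-reflexive (m+n∸n≡m n b))
    j+K≡b+n : toℕ j + K ≡ b + n
    j+K≡b+n = trans (m+[n∸m]≡n (<⇒≤ j<n+b)) (+-comm n b)
    land : toℕ (shiftF j K) ≡ b
    land with shiftF-value j K K≤n
    ... | inj₁ t≡ = ⊥-elim (<⇒≱ (toℕ<n (shiftF j K))
                      (≤-trans (m≤n+m n b) (≤-reflexive (sym (trans t≡ j+K≡b+n)))))
    ... | inj₂ t+n≡ = +-cancelʳ-≡ n _ b (trans t+n≡ j+K≡b+n)
    miss : ∀ k → 1 ≤ k → k < K → ¬ L (toℕ (shiftF j k))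
    miss k 1≤k k<K with shiftF-value j k (≤-trans (<⇒≤ k<K) K≤n)
    ... | inj₁ t≡ = gap _ (toℕ<n _) (inj₁ (subst (toℕ j <_) (sym t≡) (m<m+n (toℕ j) 1≤k)))
    ... | inj₂ t+n≡ = gap _ (toℕ<n _) (inj₂ (+-cancelʳ-< n _ b (begin-strict
      _ + n     ≡⟨ t+n≡ ⟩
      toℕ j + k <⟨ +-monoʳ-< (toℕ j) k<K ⟩
      toℕ j + K ≡⟨ j+K≡b+n ⟩
      b + n     ∎)))
      where open ≤-Reasoning

  nextB-behind : ∀ j b → b < toℕ j → L b → (∀ c → b < c → c < toℕ j → ¬ L c)
               → toℕ (nextB P j) ≡ b
  nextB-behind j b b<j Lb gap =
    trans (cong toℕ (nextB-shift j K (m<n⇒0<n∸m b<j) K≤n (subst L (sym land) Lb) miss)) land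
    where
    K : ℕ
    K = toℕ j ∸ b
    K≤j : K ≤ toℕ j
    K≤j = m∸n≤m (toℕ j) b
    K≤n : K ≤ n
    K≤n = ≤-trans K≤j (<⇒≤ (toℕ<n j))
    b+K≡j : b + K ≡ toℕ j
    b+K≡j = m+[n∸m]≡n (<⇒≤ b<j)
    no-wrap : ∀ {t k} → t < n → k ≤ K → t + k ≢ toℕ j + n
    no-wrap {t} {k} t<n k≤K e =
      <-irrefl (trans e (+-comm (toℕ j) n)) (+-mono-<-≤ t<n (≤-trans k≤K K≤j))
    land : toℕ (shiftB j K) ≡ b
    land with shiftB-value j K K≤n
    ... | inj₁ t+K≡ = ⊥-elim (no-wrap (toℕ<n _) ≤-refl t+K≡)
    ... | inj₂ t+K≡ = +-cancelʳ-≡ K _ b (trans t+K≡ (sym b+K≡j))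
    miss : ∀ k → 1 ≤ k → k < K → ¬ L (toℕ (shiftB j k))
    miss k 1≤k k<K with shiftB-value j k (≤-trans (<⇒≤ k<K) K≤n)
    ... | inj₁ t+k≡ = ⊥-elim (no-wrap (toℕ<n _) (<⇒≤ k<K) t+k≡)
    ... | inj₂ t+k≡ = gap _ (+-gap _ k b K (trans t+k≡ (sym b+K≡j)) k<K)
                            (subst (toℕ (shiftB j k) <_) t+k≡ (m<m+n _ 1≤k))

  nextB-around : ∀ j b → toℕ j ≤ b → b < n → L b → (∀ c → c < n → c < toℕ j ⊎ b < c → ¬ L c)
               → toℕ (nextB P j) ≡ b
  nextB-around j b j≤b b<n Lb gap =
    trans (cong toℕ (nextB-shift j K 1≤K K≤n (subst L (sym land) Lb) miss)) land
    where
    b<j+n : b < toℕ j + n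
    b<j+n = ≤-trans b<n (m≤n+m n (toℕ j))
    K : ℕ
    K = toℕ j + n ∸ b
    1≤K : 1 ≤ K
    1≤K = m<n⇒0<n∸m b<j+n
    K≤n : K ≤ n
    K≤n = ≤-trans (∸-monoˡ-≤ b (+-monoˡ-≤ n j≤b)) (≤-reflexive (m+n∸m≡n b n))
    b+K≡j+n : b + K ≡ toℕ j + n
    b+K≡j+n = m+[n∸m]≡n (<⇒≤ b<j+n)
    land : toℕ (shiftB j K) ≡ b
    land with shiftB-value j K K≤n
    ... | inj₁ t+K≡ = +-cancelʳ-≡ K _ b (trans t+K≡ (sym b+K≡j+n))
    ... | inj₂ t+K≡ = ⊥-elim (<-irrefl b+K≡j+n (begin-strict
      b + K <⟨ +-mono-<-≤ b<n (subst (K ≤_) t+K≡ (m≤n+m K _)) ⟩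
      n + toℕ j ≡⟨ +-comm n (toℕ j) ⟩
      toℕ j + n ∎))
      where open ≤-Reasoning
    miss : ∀ k → 1 ≤ k → k < K → ¬ L (toℕ (shiftB j k))
    miss k 1≤k k<K with shiftB-value j k (≤-trans (<⇒≤ k<K) K≤n)
    ... | inj₁ t+k≡ = gap _ (toℕ<n _) (inj₂ (+-gap _ k b K (trans t+k≡ (sym b+K≡j+n)) k<K))
    ... | inj₂ t+k≡ = gap _ (toℕ<n _) (inj₁ (subst (toℕ (shiftB j k) <_) t+k≡ (m<m+n _ 1≤k)))

iter-+ : ∀ {X : Set} (f : X → X) k₂ k₁ x → iter f (k₂ + k₁) x ≡ iter f k₂ (iter f k₁ x)
iter-+ f zero    k₁ x = refl
iter-+ f (suc k₂) k₁ x = cong f (iter-+ f k₂ k₁ x)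

Reach : ∀ {X : Set} → (X → X) → (X → Set) → (X → Set) → Set
Reach f P Q = ∀ x → P x → ∃ λ k → Q (iter f k x)

reach-refl : ∀ {X : Set} {f : X → X} {P : X → Set} → Reach f P P
reach-refl x Px = 0 , Px

reach-step : ∀ {X : Set} {f : X → X} {P Q : X → Set} → (∀ x → P x → Q (f x)) → Reach f P Q
reach-step step x Px = 1 , step x Px

reach-trans : ∀ {X : Set} {f : X → X} {P Q R : X → Set} → Reach f P Q → Reach f Q R → Reach f P R
reach-trans {f = f} {R = R} P⇝Q Q⇝R x Px with P⇝Q x Px
... | k₁ , Qy with Q⇝R _ Qy
...   | k₂ , Rz = k₂ + k₁ , subst R (sym (iter-+ f k₂ k₁ x)) Rz

singleCycle-viaHub : ∀ {m} (A : Array (suc m)) (f : Cell (suc m) → Cell (suc m)) (o : Cell (suc m))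
  → (∀ x → Filled A x → Filled A (f x))
  → (∀ x → Filled A x → ∃ λ k → iter f k x ≡ o)
  → (∀ y → Filled A y → ∃ λ k → iter f k o ≡ y)
  → SingleCycle A f
singleCycle-viaHub A f o closed toHub fromHub = closed , connected
  where
  connected : ∀ x y → Filled A x → Filled A y → ∃ λ k → iter f k x ≡ y
  connected x y Fx Fy with toHub x Fx | fromHub y Fy
  ... | k₁ , x↦o | k₂ , o↦y = k₂ + k₁ , trans (iter-+ f k₂ k₁ x) (trans (cong (iter f k₂) x↦o) o↦y)

negAt-hit : ∀ {n} ℓ (j : Fin n) → toℕ j + 1 ≡ ℓ → negAt ℓ j ≡ neg
negAt-hit ℓ j hit with toℕ j + 1 ≟ ℓ
... | yes _   = refl
... | no miss = contradiction hit miss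

negAt-miss : ∀ {n} ℓ (j : Fin n) → toℕ j + 1 ≢ ℓ → negAt ℓ j ≡ pos
negAt-miss ℓ j miss with toℕ j + 1 ≟ ℓ
... | yes hit = contradiction hit miss
... | no _    = refl

-- The cyclically almost 2-diagonal array of size n = m + 1 in standard form with
-- extra cell in column e (0-based; the paper's ℓ is e + 1).
module AlmostTwoDiagonal {m : ℕ} (A : Array (suc m)) (e : ℕ) (shape : StdAlmostDiag 2 A (suc e)) where

  private
    n : ℕ
    n = suc m

    spec : ∀ (x : Cell n) → Filled A x ⇔ ((Σ ℕ λ d → 1 ≤ d × d ≤ 2 × InDiag d x)
                                         ⊎ (toℕ (proj₁ x) ≡ 0 × toℕ (proj₂ x) + 1 ≡ suc e))
    spec = proj₂ (proj₂ (proj₂ shape))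

  1≤e : 1 ≤ e
  1≤e = s≤s⁻¹ (proj₁ (proj₂ shape))

  e<m : e < m
  e<m = bound (proj₁ shape) (proj₁ (proj₂ (proj₂ shape)))
    where
    bound : 2 < n → suc e ≤ n ∸ 2 + 1 → e < m
    bound (s≤s 1<m) e<n∸1 = ≤-trans e<n∸1 (≤-reflexive (m∸n+n≡m (<⇒≤ 1<m)))

  data Occupied : ℕ → ℕ → Set where
    main   : ∀ c → Occupied c c
    sub    : ∀ c → Occupied (suc c) c          -- diagonal D₂ above the last column
    corner : ∀ {c} → c ≡ m → Occupied 0 c      -- diagonal D₂ in the last column
    extra  : ∀ {c} → c ≡ e → Occupied 0 c

  occupied⇒filled : ∀ {a b} → Occupied a b → ∀ r c → toℕ r ≡ a → toℕ c ≡ b → Filled A (r , c)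
  occupied⇒filled (main b) r c r≡b c≡b = Equivalence.from (spec (r , c))
    (inj₁ (1 , ≤-refl , s≤s z≤n , trans r≡b (sym (trans (m<n⇒m%n≡m (toℕ<n c)) c≡b))))
  occupied⇒filled (sub b) r c r≡1+b c≡b = Equivalence.from (spec (r , c))
    (inj₁ (2 , s≤s z≤n , ≤-refl , trans r≡1+b (sym (begin
      suc (toℕ c) % n ≡⟨ cong (λ x → suc x % n) c≡b ⟩
      suc b % n       ≡⟨ m<n⇒m%n≡m (subst (_< n) r≡1+b (toℕ<n r)) ⟩
      suc b           ∎))))
    where open ≡-Reasoning
  occupied⇒filled (corner b≡m) r c r≡0 c≡b = Equivalence.from (spec (r , c))
    (inj₁ (2 , s≤s z≤n , ≤-refl , trans r≡0 (sym (trans (cong (λ x → suc x % n) (trans c≡b b≡m)) (n%n≡0 n)))))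
  occupied⇒filled (extra b≡e) r c r≡0 c≡b = Equivalence.from (spec (r , c))
    (inj₂ (r≡0 , trans (cong (_+ 1) (trans c≡b b≡e)) (+-comm e 1)))

  filled⇒occupied : ∀ x → Filled A x → Occupied (toℕ (proj₁ x)) (toℕ (proj₂ x))
  filled⇒occupied (r , c) filled with Equivalence.to (spec (r , c)) filled
  ... | inj₁ (1 , _ , _ , r≡c%n) =
    subst (λ a → Occupied a (toℕ c)) (sym (trans r≡c%n (m<n⇒m%n≡m (toℕ<n c)))) (main (toℕ c))
  ... | inj₁ (2 , _ , _ , r≡1+c%n) with m≤n⇒m<n∨m≡n (s≤s⁻¹ (toℕ<n c))
  ...   | inj₁ c<m = subst (λ a → Occupied a (toℕ c)) (sym (trans r≡1+c%n (m<n⇒m%n≡m (s≤s c<m)))) (sub (toℕ c))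
  ...   | inj₂ c≡m = subst (λ a → Occupied a (toℕ c))
                       (sym (trans r≡1+c%n (trans (cong (λ x → suc x % n) c≡m) (n%n≡0 n)))) (corner c≡m)
  filled⇒occupied (r , c) filled | inj₁ (suc (suc (suc _)) , _ , s≤s (s≤s ()) , _)
  filled⇒occupied (r , c) filled | inj₂ (r≡0 , c+1≡1+e) =
    subst (λ a → Occupied a (toℕ c)) (sym r≡0) (extra (suc-injective (trans (+-comm 1 (toℕ c)) c+1≡1+e)))

  filled⇔occupied : ∀ r c → Filled A (r , c) ⇔ Occupied (toℕ r) (toℕ c)
  filled⇔occupied r c = mk⇔ (filled⇒occupied (r , c)) (λ occ → occupied⇒filled occ r c refl refl)

  At : ℕ → ℕ → Cell n → Set
  At a b x = toℕ (proj₁ x) ≡ a × toℕ (proj₂ x) ≡ b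

  at-unique : ∀ {a b} x y → At a b x → At a b y → x ≡ y
  at-unique (r , c) (r' , c') (r≡a , c≡b) (r'≡a , c'≡b) =
    cong₂ _,_ (toℕ-injective (trans r≡a (sym r'≡a))) (toℕ-injective (trans c≡b (sym c'≡b)))

  private
    module Row (i : Fin n) = Line (A i) (Occupied (toℕ i)) (filled⇔occupied i)
    module Col (j : Fin n) = Line (λ r → A r j) (λ a → Occupied a (toℕ j)) (λ r → filled⇔occupied r j)

  row-ahead : ∀ {a b} b' x → At a b x → b < b' → b' < n → Occupied a b'
            → (∀ c → b < c → c < b' → ¬ Occupied a c) → At a b' (sr A x)
  row-ahead b' (i , j) (refl , refl) b<b' b'<n occ gap = refl , Row.nextF-ahead i j b' b<b' b'<n occ gap

  row-around : ∀ {a b} b' x → At a b x → b' ≤ b → Occupied a b'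
             → (∀ c → c < n → b < c ⊎ c < b' → ¬ Occupied a c) → At a b' (sr A x)
  row-around b' (i , j) (refl , refl) b'≤b occ gap = refl , Row.nextF-around i j b' b'≤b occ gap

  col-ahead : ∀ {a b} a' x → At a b x → a < a' → a' < n → Occupied a' b
            → (∀ r → a < r → r < a' → ¬ Occupied r b) → At a' b (sc A x)
  col-ahead a' (i , j) (refl , refl) a<a' a'<n occ gap = Col.nextF-ahead j i a' a<a' a'<n occ gap , refl

  col-around : ∀ {a b} a' x → At a b x → a' ≤ a → Occupied a' b
             → (∀ r → r < n → a < r ⊎ r < a' → ¬ Occupied r b) → At a' b (sc A x)
  col-around a' (i , j) (refl , refl) a'≤a occ gap = Col.nextF-around j i a' a'≤a occ gap , refl

  col-behind : ∀ {a b} a' x → At a b x → a' < a → Occupied a' b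
             → (∀ r → a' < r → r < a → ¬ Occupied r b) → At a' b (sc⁻¹ A x)
  col-behind a' (i , j) (refl , refl) a'<a occ gap = Col.nextB-behind j i a' a'<a occ gap , refl

  col-behind-around : ∀ {a b} a' x → At a b x → a ≤ a' → a' < n → Occupied a' b
                    → (∀ r → r < n → r < a ⊎ a' < r → ¬ Occupied r b) → At a' b (sc⁻¹ A x)
  col-behind-around a' (i , j) (refl , refl) a≤a' a'<n occ gap =
    Col.nextB-around j i a' a≤a' a'<n occ gap , refl

  move : Cell n → Cell n
  move = S A allPos (negAt (suc e))

  move-down : ∀ {a b a'} x → At a b (sr A x) → b ≢ e → At a' b (sc A (sr A x)) → At a' b (move x)
  move-down {b = b} {a' = a'} (i , j) (_ , col≡b) b≢e reached =
    subst (λ s → At a' b (colStep A s (sr A (i , j)))) (sym (negAt-miss (suc e) _ col+1≢ℓ)) reached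
    where
    col+1≢ℓ : toℕ (proj₂ (sr A (i , j))) + 1 ≢ suc e
    col+1≢ℓ col+1≡ℓ = b≢e (trans (sym col≡b) (suc-injective (trans (+-comm 1 _) col+1≡ℓ)))

  move-up : ∀ {a b a'} x → At a b (sr A x) → b ≡ e → At a' b (sc⁻¹ A (sr A x)) → At a' b (move x)
  move-up {b = b} {a' = a'} (i , j) (_ , col≡b) b≡e reached =
    subst (λ s → At a' b (colStep A s (sr A (i , j)))) (sym (negAt-hit (suc e) _ col+1≡ℓ)) reached
    where
    col+1≡ℓ : toℕ (proj₂ (sr A (i , j))) + 1 ≡ suc e
    col+1≡ℓ = trans (+-comm _ 1) (cong suc (trans col≡b b≡e))

  _↦_ : ℕ × ℕ → ℕ × ℕ → Set
  (a , b) ↦ (a' , b') = ∀ x → At a b x → At a' b' (move x)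

  -- (0,0): along row 0 to the extra cell, then up column e, wrapping to (e+1, e)
  step-origin : (0 , 0) ↦ (suc e , e)
  step-origin x at =
    move-up x to-extra refl (col-behind-around (suc e) (sr A x) to-extra z≤n (s≤s e<m) (sub e) col-gap)
    where
    row-gap : ∀ c → 0 < c → c < e → ¬ Occupied 0 c
    row-gap c 0<c c<e (main _)     = n≮0 0<c
    row-gap c 0<c c<e (corner c≡m) = <-asym c<e (subst (e <_) (sym c≡m) e<m)
    row-gap c 0<c c<e (extra c≡e)  = <-irrefl c≡e c<e
    to-extra : At 0 e (sr A x)
    to-extra = row-ahead e x at 1≤e (m<n⇒m<1+n e<m) (extra refl) row-gap
    col-gap : ∀ r → r < n → r < 0 ⊎ suc e < r → ¬ Occupied r e
    col-gap r r<n (inj₂ 1+e<r) (main _) = <-asym (n<1+n e) 1+e<r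
    col-gap r r<n (inj₂ 1+e<r) (sub _)  = <-irrefl refl 1+e<r

  -- (c+1, c+1): along row c+1, wrapping to (c+1, c), then along column c to (c, c):
  -- one step back if c = e, otherwise forwards around the whole column
  step-main : ∀ c → c < m → (suc c , suc c) ↦ (c , c)
  step-main c c<m x at = column-step (c ≟ e)
    where
    row-gap : ∀ b → b < n → suc c < b ⊎ b < c → ¬ Occupied (suc c) b
    row-gap b _ (inj₁ 1+c<b) (main _) = <-irrefl refl 1+c<b
    row-gap b _ (inj₂ b<c)   (main _) = <-asym b<c (n<1+n c)
    row-gap b _ (inj₁ 1+c<b) (sub _)  = <-asym 1+c<b (n<1+n c)
    row-gap b _ (inj₂ b<c)   (sub _)  = <-irrefl refl b<c
    to-sub : At (suc c) c (sr A x)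
    to-sub = row-around c x at (n≤1+n c) (sub c) row-gap
    col-gap : c ≢ e → ∀ r → r < n → suc c < r ⊎ r < c → ¬ Occupied r c
    col-gap _   r _ (inj₁ 1+c<r) (main _)     = <-asym 1+c<r (n<1+n c)
    col-gap _   r _ (inj₂ r<c)   (main _)     = <-irrefl refl r<c
    col-gap _   r _ (inj₁ 1+c<r) (sub _)      = <-irrefl refl 1+c<r
    col-gap _   r _ (inj₂ r<c)   (sub _)      = <-asym r<c (n<1+n c)
    col-gap _   r _ _            (corner c≡m) = <-irrefl c≡m c<m
    col-gap c≢e r _ _            (extra c≡e)  = c≢e c≡e
    column-step : Dec (c ≡ e) → At c c (move x)
    column-step (yes c≡e) = move-up x to-sub c≡e
      (col-behind c (sr A x) to-sub ≤-refl (main c) (λ r c<r r<1+c _ → no-between c<r r<1+c))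
    column-step (no c≢e) = move-down x to-sub c≢e
      (col-around c (sr A x) to-sub (n≤1+n c) (main c) (col-gap c≢e))

  row-sub : ∀ c → c < m → ∀ x → At (suc c) c x → At (suc c) (suc c) (sr A x)
  row-sub c c<m x at =
    row-ahead (suc c) x at ≤-refl (s≤s c<m) (main (suc c)) (λ b c<b b<1+c _ → no-between c<b b<1+c)

  -- (c+1, c) then moves down column c+1 to (c+2, c+1) …
  step-climb : ∀ c → suc c < m → suc c ≢ e → (suc c , c) ↦ (suc (suc c) , suc c)
  step-climb c 1+c<m 1+c≢e x at = move-down x on-main 1+c≢e
    (col-ahead (suc (suc c)) (sr A x) on-main ≤-refl (s≤s 1+c<m) (sub (suc c))
               (λ r 1+c<r r<2+c _ → no-between 1+c<r r<2+c))
    where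
    on-main : At (suc c) (suc c) (sr A x)
    on-main = row-sub c (<-trans (n<1+n c) 1+c<m) x at

  -- … unless column c+1 is the extra column, whose step goes up to the extra cell …
  step-toExtra : ∀ c → suc c ≡ e → (suc c , c) ↦ (0 , e)
  step-toExtra c 1+c≡e x at = subst (λ b → At 0 b (move x)) 1+c≡e (move-up x on-main 1+c≡e
    (col-behind 0 (sr A x) on-main (s≤s z≤n) (extra 1+c≡e) col-gap))
    where
    on-main : At (suc c) (suc c) (sr A x)
    on-main = row-sub c (<-trans (n<1+n c) (subst (_< m) (sym 1+c≡e) e<m)) x at
    col-gap : ∀ r → 0 < r → r < suc c → ¬ Occupied r (suc c)
    col-gap r _ r<1+c (main _) = <-irrefl refl r<1+c
    col-gap r _ r<1+c (sub _)  = <-asym r<1+c (n<1+n (suc c))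
    col-gap r () _ (corner _)
    col-gap r () _ (extra _)

  -- … or the last column, whose step wraps down to the corner cell (0, m)
  step-toCorner : ∀ c → suc c ≡ m → (suc c , c) ↦ (0 , m)
  step-toCorner c 1+c≡m x at = subst (λ b → At 0 b (move x)) 1+c≡m (move-down x on-main 1+c≢e
    (col-around 0 (sr A x) on-main z≤n (corner 1+c≡m) col-gap))
    where
    on-main : At (suc c) (suc c) (sr A x)
    on-main = row-sub c (subst (c <_) 1+c≡m (n<1+n c)) x at
    1+c≢e : suc c ≢ e
    1+c≢e 1+c≡e = <-irrefl (trans (sym 1+c≡e) 1+c≡m) e<m
    col-gap : ∀ r → r < n → suc c < r ⊎ r < 0 → ¬ Occupied r (suc c)
    col-gap r r<n (inj₁ 1+c<r) _ = <⇒≱ (subst (_< r) 1+c≡m 1+c<r) (s≤s⁻¹ r<n)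

  -- the corner cell (0, m) moves along row 0, wrapping to (0, 0), then down to (1, 0)
  step-corner : (0 , m) ↦ (1 , 0)
  step-corner x at = move-down x to-origin 0≢e
    (col-ahead 1 (sr A x) to-origin (s≤s z≤n) (s≤s (≤-trans 1≤e (<⇒≤ e<m))) (sub 0) (λ r 0<r r<1 _ → no-between 0<r r<1))
    where
    to-origin : At 0 0 (sr A x)
    to-origin = row-around 0 x at z≤n (main 0) (λ { c c<n (inj₁ m<c) _ → no-between m<c c<n })
    0≢e : 0 ≢ e
    0≢e 0≡e = <-irrefl 0≡e 1≤e

  -- the extra cell (0, e) moves along row 0 to the corner (0, m), then down to (m, m)
  step-extra : (0 , e) ↦ (m , m)
  step-extra x at = move-down x to-corner (λ m≡e → <-irrefl (sym m≡e) e<m)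
    (col-ahead m (sr A x) to-corner (≤-trans (s≤s z≤n) e<m) ≤-refl (main m) col-gap)
    where
    row-gap : ∀ c → e < c → c < m → ¬ Occupied 0 c
    row-gap c e<c _   (main _)     = n≮0 e<c
    row-gap c _   c<m (corner c≡m) = <-irrefl c≡m c<m
    row-gap c e<c _   (extra c≡e)  = <-irrefl (sym c≡e) e<c
    to-corner : At 0 m (sr A x)
    to-corner = row-ahead m x at e<m ≤-refl (corner refl) row-gap
    col-gap : ∀ r → 0 < r → r < m → ¬ Occupied r m
    col-gap r _ r<m (main _) = <-irrefl refl r<m
    col-gap r _ r<m (sub _)  = <-asym r<m (n<1+n m)

  _⇝_ : ℕ × ℕ → ℕ × ℕ → Set
  (a , b) ⇝ (a' , b') = Reach move (At a b) (At a' b')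

  step : ∀ {a b a' b'} → (a , b) ↦ (a' , b') → (a , b) ⇝ (a' , b')
  step {a} {b} {a'} {b'} = reach-step {f = move} {At a b} {At a' b'}

  infixr 5 _▸_
  _▸_ : ∀ {a b a' b' a'' b''} → (a , b) ⇝ (a' , b') → (a' , b') ⇝ (a'' , b'') → (a , b) ⇝ (a'' , b'')
  _▸_ {a} {b} {a'} {b'} {a''} {b''} = reach-trans {f = move} {At a b} {At a' b'} {At a'' b''}

  descend : ∀ c c' → c ≤ c' → c' ≤ m → (c' , c') ⇝ (c , c)
  descend c zero z≤n _ = reach-refl
  descend c (suc c') c≤1+c' 1+c'≤m with m≤n⇒m<n∨m≡n c≤1+c'
  ... | inj₁ c<1+c' = step (step-main c' 1+c'≤m) ▸ descend c c' (s≤s⁻¹ c<1+c') (<⇒≤ 1+c'≤m)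
  ... | inj₂ refl   = reach-refl

  climb : ∀ c c' → c ≤ c' → c' < m → (∀ i → c < i → i ≤ c' → i ≢ e) → (suc c , c) ⇝ (suc c' , c')
  climb c zero z≤n _ _ = reach-refl
  climb c (suc c') c≤1+c' 1+c'<m avoid with m≤n⇒m<n∨m≡n c≤1+c'
  ... | inj₁ c<1+c' =
    climb c c' (s≤s⁻¹ c<1+c') (<-trans (n<1+n c') 1+c'<m) (λ i c<i i≤c' → avoid i c<i (m≤n⇒m≤1+n i≤c'))
    ▸ step (step-climb c' 1+c'<m (avoid (suc c') c<1+c' ≤-refl))
  ... | inj₂ refl = reach-refl

  private
    suc-pred-of : ∀ {a b} → a < b → suc (pred b) ≡ b
    suc-pred-of (s≤s _) = refl

  origin⇝upper : ∀ c → e ≤ c → c < m → (0 , 0) ⇝ (suc c , c)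
  origin⇝upper c e≤c c<m =
    step step-origin ▸ climb e c e≤c c<m (λ i e<i _ i≡e → <-irrefl (sym i≡e) e<i)

  upper⇝corner : ∀ c → e ≤ c → c < m → (suc c , c) ⇝ (0 , m)
  upper⇝corner c e≤c c<m =
    climb c (pred m) (<⇒≤pred c<m) (subst (pred m <_) (suc-pred-of e<m) ≤-refl)
          (λ i c<i _ i≡e → <-irrefl (sym i≡e) (≤-<-trans e≤c c<i))
    ▸ step (step-toCorner (pred m) (suc-pred-of e<m))

  corner⇝lower : ∀ c → c < e → (0 , m) ⇝ (suc c , c)
  corner⇝lower c c<e =
    step step-corner ▸ climb 0 c z≤n (<-trans c<e e<m) (λ i _ i≤c i≡e → <-irrefl i≡e (≤-<-trans i≤c c<e))

  lower⇝extra : ∀ c → c < e → (suc c , c) ⇝ (0 , e)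
  lower⇝extra c c<e =
    climb c (pred e) (<⇒≤pred c<e) (<-trans (subst (pred e <_) (suc-pred-of c<e) ≤-refl) e<m)
          (λ i _ i≤pe i≡e → <-irrefl i≡e (≤-<-trans i≤pe (subst (pred e <_) (suc-pred-of c<e) ≤-refl)))
    ▸ step (step-toExtra (pred e) (suc-pred-of c<e))

  extra⇝main : ∀ c → c ≤ m → (0 , e) ⇝ (c , c)
  extra⇝main c c≤m = step step-extra ▸ descend c m c≤m ≤-refl

  main⇝origin : ∀ c → c ≤ m → (c , c) ⇝ (0 , 0)
  main⇝origin c c≤m = descend 0 c z≤n c≤m

  origin⇝corner : (0 , 0) ⇝ (0 , m)
  origin⇝corner = origin⇝upper e ≤-refl e<m ▸ upper⇝corner e ≤-refl e<m

  corner⇝extra : (0 , m) ⇝ (0 , e)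
  corner⇝extra = corner⇝lower 0 1≤e ▸ lower⇝extra 0 1≤e

  extra⇝origin : (0 , e) ⇝ (0 , 0)
  extra⇝origin = extra⇝main 0 z≤n

  occupied⇝origin : ∀ {a b} → a < n → b < n → Occupied a b → (a , b) ⇝ (0 , 0)
  occupied⇝origin _ c<n (main c) = main⇝origin c (s≤s⁻¹ c<n)
  occupied⇝origin 1+c<n _ (sub c) with c <? e
  ... | yes c<e = lower⇝extra c c<e ▸ extra⇝origin
  ... | no c≮e  = upper⇝corner c (≮⇒≥ c≮e) (s≤s⁻¹ 1+c<n) ▸ corner⇝extra ▸ extra⇝origin
  occupied⇝origin _ _ (corner refl) = corner⇝extra ▸ extra⇝origin
  occupied⇝origin _ _ (extra refl)  = extra⇝origin

  origin⇝occupied : ∀ {a b} → a < n → b < n → Occupied a b → (0 , 0) ⇝ (a , b)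
  origin⇝occupied _ c<n (main c) = origin⇝corner ▸ corner⇝extra ▸ extra⇝main c (s≤s⁻¹ c<n)
  origin⇝occupied 1+c<n _ (sub c) with c <? e
  ... | yes c<e = origin⇝corner ▸ corner⇝lower c c<e
  ... | no c≮e  = origin⇝upper c (≮⇒≥ c≮e) (s≤s⁻¹ 1+c<n)
  origin⇝occupied _ _ (corner refl) = origin⇝corner
  origin⇝occupied _ _ (extra refl)  = origin⇝corner ▸ corner⇝extra

  move-occupied : ∀ {a b} → a < n → Occupied a b → ∃₂ λ a' b' → Occupied a' b' × (a , b) ↦ (a' , b')
  move-occupied _      (main zero)    = suc e , e , sub e , step-origin
  move-occupied 1+c<n  (main (suc c)) = c , c , main c , step-main c (s≤s⁻¹ 1+c<n)
  move-occupied 1+c<n  (sub c) with suc c ≟ e | suc c ≟ m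
  ... | yes 1+c≡e | _        = 0 , e , extra refl , step-toExtra c 1+c≡e
  ... | no _      | yes 1+c≡m = 0 , m , corner refl , step-toCorner c 1+c≡m
  ... | no 1+c≢e  | no 1+c≢m  = suc (suc c) , suc c , sub (suc c) ,
                                 step-climb c (≤∧≢⇒< (s≤s⁻¹ 1+c<n) 1+c≢m) 1+c≢e
  move-occupied _ (corner refl) = 1 , 0 , sub 0 , step-corner
  move-occupied _ (extra refl)  = m , m , main m , step-extra

  solution : IsSolution A allPos (negAt (suc e))
  solution = singleCycle-viaHub A move origin closed reaches-origin reached-from-origin
    where
    origin : Cell n
    origin = zero , zero
    closed : ∀ x → Filled A x → Filled A (move x)
    closed x filled with move-occupied (toℕ<n (proj₁ x)) (filled⇒occupied x filled)
    ... | _ , _ , occ , moves with moves x (refl , refl)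
    ...   | r≡ , c≡ = occupied⇒filled occ _ _ r≡ c≡
    reaches-origin : ∀ x → Filled A x → ∃ λ k → iter move k x ≡ origin
    reaches-origin x filled with occupied⇝origin (toℕ<n _) (toℕ<n _) (filled⇒occupied x filled) x (refl , refl)
    ... | k , at = k , at-unique _ origin at (refl , refl)
    reached-from-origin : ∀ y → Filled A y → ∃ λ k → iter move k origin ≡ y
    reached-from-origin y filled with origin⇝occupied (toℕ<n _) (toℕ<n _) (filled⇒occupied y filled) origin (refl , refl)
    ... | k , at = k , at-unique _ y at (refl , refl)

-- Standard form forces ℓ ≥ 2 (and n ≥ 3); for ℓ = e + 1 the array is the one studied above.
proposition5p11 : (m : ℕ) → 3 ≤ suc m → (A : Array (suc m)) → (ℓ : ℕ)
                  → StdAlmostDiag 2 A ℓ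
                  → IsSolution A allPos (negAt ℓ)
proposition5p11 m _ A zero    (_ , () , _)
proposition5p11 m _ A (suc e) shape = AlmostTwoDiagonal.solution A e shape
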